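{- For every positive integer $n$, $m_2(C_3,C_4,nK_2)=\infty$.
   Context: $K_{j\times t}$ denotes the complete multipartite graph with $j$ partite sets, each of size $t$. For graphs $H_1,\ldots,H_k$, the multipartite Ramsey number $m_j(H_1,\ldots,H_k)$ is the smallest positive integer $t$ such that for every $k$-edge-coloring $(G^1,\ldots,G^k)$ of $K_{j\times t}$ (partition of its edges into spanning subgraphs), some $G^\ell$ contains a copy of $H_\ell$; it is $\infty$ if no such $t$ exists. $C_m$ is the cycle on $m$ vertices and $nK_2$ is a matching of $n$ edges. -}

module Defs where

open import Data.Nat using (ℕ; zero; suc; _≥_)
open import Data.Fin using (Fin; toℕ)
open import Data.Bool using (Bool)
open import Data.Product using (Σ; ∃; _×_; _,_)
open import Data.Sum using (_⊎_)
open import Relation.Nullary using (¬_)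
open import Relation.Binary.PropositionalEquality using (_≡_; _≢_)
open import Function.Definitions using (Injective)

record Graph : Set₁ where
  field
    V   : Set
    Adj : V → V → Set
open Graph public

-- H ⊆ G : an injective vertex map sending edges of H to edges of G
-- (a copy of H as a (not necessarily induced) subgraph of G).
Contains : Graph → Graph → Set
Contains G H =
  Σ (V H → V G) λ f → Injective _≡_ _≡_ f × (∀ u v → Adj H u v → Adj G (f u) (f v))

-- The cycle C_m on vertices 0,…,m-1, with i ~ i+1 and m-1 ~ 0.
cycNext : (m : ℕ) → Fin m → Fin m → Set
cycNext m i j = (toℕ j ≡ suc (toℕ i)) ⊎ ((suc (toℕ i) ≡ m) × (toℕ j ≡ 0))

C : ℕ → Graph
C m = record { V = Fin m ; Adj = λ i j → cycNext m i j ⊎ cycNext m j i }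

matching : ℕ → Graph
matching n = record
  { V = Fin n × Bool
  ; Adj = λ { (i , a) (i' , b) → (i ≡ i') × (a ≢ b) } }

-- The complete multipartite graph K_{j×t}: vertex (p , x) lies in part p.
KAdj : (j t : ℕ) → Fin j × Fin t → Fin j × Fin t → Set
KAdj j t (p , x) (q , y) = p ≢ q

-- A k-edge-colouring of K_{j×t}: a symmetric colour assignment
-- (values on non-edges are irrelevant).
record Colouring (k j t : ℕ) : Set where
  field
    col : Fin j × Fin t → Fin j × Fin t → Fin k
    sym : ∀ u v → col u v ≡ col v u
open Colouring public

colourClass : ∀ {k j t} → Colouring k j t → Fin k → Graph
colourClass {k} {j} {t} c ℓ = record
  { V = Fin j × Fin t
  ; Adj = λ u v → KAdj j t u v × (col c u v ≡ ℓ) }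

-- t "works" for m_j(H_1,…,H_k): every k-colouring of K_{j×t} has some G^ℓ ⊇ H_ℓ.
RamseyArrow : (k j t : ℕ) → (Fin k → Graph) → Set
RamseyArrow k j t Hs = ∀ (c : Colouring k j t) → ∃ λ ℓ → Contains (colourClass c ℓ) (Hs ℓ)

MultipartiteRamseyInfinite : (k j : ℕ) → (Fin k → Graph) → Set
MultipartiteRamseyInfinite k j Hs = ∀ (t : ℕ) → t ≥ 1 → ¬ RamseyArrow k j t Hs

C3C4nK2 : ℕ → Fin 3 → Graph
C3C4nK2 n Fin.zero = C 3
C3C4nK2 n (Fin.suc Fin.zero) = C 4
C3C4nK2 n (Fin.suc (Fin.suc Fin.zero)) = matching n

module Submission where

-- K_{2×t} is bipartite, so no colour class of any colouring contains a
-- triangle. Colouring every edge with the first colour therefore avoids C₃,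
-- and leaves the other two colour classes edgeless, so they avoid C₄ and nK₂
-- (the latter has an edge as soon as n ≥ 1).

open import Defs
open import Data.Nat using (ℕ; suc; _≥_)
open import Data.Fin using (Fin; zero; suc)
open import Data.Bool using (true; false)
open import Data.Empty using (⊥)
open import Data.Product using (∃; _,_; proj₁; proj₂)
open import Data.Sum using (inj₁; inj₂)
open import Relation.Nullary using (¬_)
open import Relation.Binary.PropositionalEquality using (_≢_; refl)

Edgeless : Graph → Set
Edgeless G = ∀ u v → ¬ Adj G u v

HasEdge : Graph → Set
HasEdge H = ∃ λ u → ∃ λ v → Adj H u v

¬Contains-edgeless : ∀ {G H} → Edgeless G → HasEdge H → ¬ Contains G H
¬Contains-edgeless noEdge (u , v , uv) (f , _ , hom) = noEdge (f u) (f v) (hom u v uv)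

Fin2-no-three-distinct : (a b c : Fin 2) → a ≢ b → b ≢ c → c ≢ a → ⊥
Fin2-no-three-distinct zero       zero       _          a≢b _   _   = a≢b refl
Fin2-no-three-distinct (suc zero) (suc zero) _          a≢b _   _   = a≢b refl
Fin2-no-three-distinct zero       (suc zero) zero       _   _   c≢a = c≢a refl
Fin2-no-three-distinct zero       (suc zero) (suc zero) _   b≢c _   = b≢c refl
Fin2-no-three-distinct (suc zero) zero       zero       _   b≢c _   = b≢c refl
Fin2-no-three-distinct (suc zero) zero       (suc zero) _   _   c≢a = c≢a refl

bipartite-colourClass-triangle-free :
  ∀ {k t} (c : Colouring k 2 t) ℓ → ¬ Contains (colourClass c ℓ) (C 3)
bipartite-colourClass-triangle-free c ℓ (f , _ , hom) =
  Fin2-no-three-distinct _ _ _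
    (proj₁ (hom zero       (suc zero)       (inj₁ (inj₁ refl))))
    (proj₁ (hom (suc zero) (suc (suc zero)) (inj₁ (inj₁ refl))))
    (proj₁ (hom (suc (suc zero)) zero       (inj₁ (inj₂ (refl , refl)))))

monochromatic : ∀ {k j t} → Fin k → Colouring k j t
monochromatic ℓ = record { col = λ _ _ → ℓ ; sym = λ _ _ → refl }

monochromatic-other-colour-edgeless :
  ∀ {k j t} {ℓ ℓ′ : Fin k} → ℓ ≢ ℓ′ → Edgeless (colourClass (monochromatic {j = j} {t} ℓ) ℓ′)
monochromatic-other-colour-edgeless ℓ≢ℓ′ _ _ (_ , ℓ≡ℓ′) = ℓ≢ℓ′ ℓ≡ℓ′

C4-hasEdge : HasEdge (C 4)
C4-hasEdge = zero , suc zero , inj₁ (inj₁ refl)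

matching-hasEdge : ∀ n → HasEdge (matching (suc n))
matching-hasEdge n = (zero , true) , (zero , false) , refl , λ ()

theorem12 : ∀ (n : ℕ) → n ≥ 1 → MultipartiteRamseyInfinite 3 2 (C3C4nK2 n)
theorem12 (suc n) _ t _ arrow with arrow (monochromatic zero)
... | zero , copy =
  bipartite-colourClass-triangle-free (monochromatic zero) zero copy
... | suc zero , copy =
  ¬Contains-edgeless (monochromatic-other-colour-edgeless λ ()) C4-hasEdge copy
... | suc (suc zero) , copy =
  ¬Contains-edgeless (monochromatic-other-colour-edgeless λ ()) (matching-hasEdge n) copy
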